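{- Let $n\geq 2$, $N=1+2^n$, and let $\mathcal{S}_n$ be the $(\leq,\circ)$-structure with underlying set $S_n=\{0,b,c\}\cup\{a_i,a_ib,a_ic: i<N\}$ (these $3+3N$ symbols being distinct), where $a_i\circ b=a_ib$, $a_i\circ c=a_ic$ for all $i<N$ and every other product equals $0$, and where $\leq$ is the reflexive closure of $\{(s,0):s\in S_n\}\cup\{(a_{i+1}b,a_i),(a_i,a_{i+1}c),(a_ib,a_ic): i<N\}$, with $i+1$ computed modulo $N$. Then $\mathcal{S}_n\notin R(\sqsubseteq,;)$, but $\mathcal{S}_n$ satisfies $\sigma_k$ for every $k<n$.
   Context: For binary relations $R,S$ on a set $X$: $R;S=\{(x,y):\exists z\,((x,z)\in R\wedge(z,y)\in S)\}$; $\mathrm{dom}(S)=\{x:\exists y\,(x,y)\in S\}$; $R\restriction_{Y}=\{(x,y)\in R: x\in Y\}$; demonic refinement $R\sqsubseteq S\iff(\mathrm{dom}(S)\subseteq\mathrm{dom}(R)\wedge R\restriction_{\mathrm{dom}(S)}\subseteq S)$. $R(\sqsubseteq,;)$ is the class of $(\leq,\circ)$-structures isomorphic to a set of binary relations on some base set, closed under $;$, with $\leq$ interpreted as $\sqsubseteq$ and $\circ$ as $;$. In a $(\leq,\circ)$-structure define for $n<\omega$: $a\blacktriangleleft_0 b\iff a\geq b\ \vee\ \exists c\,(a\geq b\circ c)$; $a\triangleleft^s_0 b\iff (a\leq b\wedge s=b)$; $a\blacktriangleleft_{n+1}b\iff a\triangleleft^a_n b\ \vee\ \exists c\,(a\blacktriangleleft_n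 c\wedge c\blacktriangleleft_n b)\ \vee\ \exists d,f,f'\,(a=d\circ f\wedge f\blacktriangleleft_n f'\wedge b=d\circ f')$; $a\triangleleft^s_{n+1}b\iff \exists c\,(a\triangleleft^s_n c\wedge c\triangleleft^s_n b)\ \vee\ \exists c,c',d,d'\,(a=c\circ d\wedge c\triangleleft^s_n c'\wedge d\triangleleft^d_n d'\wedge b=c'\circ d')\ \vee\ \exists s'\,(a\triangleleft^{s'}_n b\wedge s\blacktriangleleft_n s')$. The first-order sentence $\sigma_k$ is $\forall a,b\,((b\blacktriangleleft_k a\wedge a\triangleleft^b_k b)\rightarrow a\leq b)$. (Note: in the structure, the variables of these formulas are not to be confused with the specific elements named $b,c$.) -}

module Defs where

open import Level using (Level; _⊔_) renaming (suc to lsuc)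
open import Data.Nat using (ℕ; zero; suc; _+_; _^_)
open import Data.Nat.DivMod using (_mod_)
open import Data.Fin using (Fin; toℕ)
open import Data.Product using (Σ; ∃; ∃-syntax; _×_; _,_)
open import Data.Sum using (_⊎_)
open import Relation.Binary.PropositionalEquality using (_≡_)

record LCStructure : Set₁ where
  field
    Carrier : Set
    _≤_     : Carrier → Carrier → Set
    _∘_     : Carrier → Carrier → Carrier

BRel : ∀ {ℓ} → Set ℓ → Set (lsuc ℓ)
BRel {ℓ} X = X → X → Set ℓ

module _ {ℓ} {X : Set ℓ} where

  _⨾_ : BRel X → BRel X → BRel X
  (R ⨾ S) x y = ∃[ z ] (R x z × S z y)

  dom : BRel X → X → Set ℓ
  dom S x = ∃[ y ] S x y

  _⊑_ : BRel X → BRel X → Set ℓ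
  R ⊑ S = (∀ x → dom S x → dom R x) × (∀ x y → dom S x → R x y → S x y)

  _≐_ : BRel X → BRel X → Set ℓ
  R ≐ S = ∀ x y → (R x y → S x y) × (S x y → R x y)

-- Membership in R(⊑,;): an isomorphism onto a ;-closed set of binary
-- relations on some base set X (given as an injective map θ that turns
-- ∘ into ; and for which s ≤ t ⇔ θ s ⊑ θ t; its image is then ;-closed).

record Representation (ℓ : Level) (𝒮 : LCStructure) : Set (lsuc ℓ) where
  open LCStructure 𝒮
  field
    Base      : Set ℓ
    θ         : Carrier → BRel Base
    injective : ∀ s t → θ s ≐ θ t → s ≡ t
    hom-∘     : ∀ s t → θ (s ∘ t) ≐ (θ s ⨾ θ t)
    ≤→⊑       : ∀ s t → s ≤ t → θ s ⊑ θ t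
    ⊑→≤       : ∀ s t → θ s ⊑ θ t → s ≤ t

Representable : (ℓ : Level) → LCStructure → Set (lsuc ℓ)
Representable ℓ 𝒮 = Representation ℓ 𝒮

module Formulas (𝒮 : LCStructure) where
  open LCStructure 𝒮

  -- ◀ n a b  is  a ◀ₙ b ;  ◁ n s a b  is  a ◁ˢₙ b
  ◀ : ℕ → Carrier → Carrier → Set
  ◁ : ℕ → Carrier → Carrier → Carrier → Set

  ◀ zero a b = (b ≤ a) ⊎ (∃[ c ] ((b ∘ c) ≤ a))
  ◀ (suc n) a b =
    ◁ n a a b
    ⊎ (∃[ c ] (◀ n a c × ◀ n c b))
    ⊎ (∃[ d ] ∃[ f ] ∃[ f′ ] (a ≡ d ∘ f × ◀ n f f′ × b ≡ d ∘ f′))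

  ◁ zero s a b = (a ≤ b) × (s ≡ b)
  ◁ (suc n) s a b =
    (∃[ c ] (◁ n s a c × ◁ n s c b))
    ⊎ (∃[ c ] ∃[ c′ ] ∃[ d ] ∃[ d′ ]
         (a ≡ c ∘ d × ◁ n s c c′ × ◁ n d d d′ × b ≡ c′ ∘ d′))
    ⊎ (∃[ s′ ] (◁ n s′ a b × ◀ n s s′))

  σ : ℕ → Set
  σ k = ∀ a b → ◀ k b a × ◁ k b a b → a ≤ b

module Sn (n : ℕ) where

  N : ℕ
  N = 1 + 2 ^ n

  succ : Fin N → Fin N
  succ i = suc (toℕ i) mod N

  data Elem : Set where
    𝟘 b c : Elem
    a ab ac : Fin N → Elem

  _∙_ : Elem → Elem → Elem
  a i ∙ b = ab i
  a i ∙ c = ac i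
  _ ∙ _ = 𝟘

  data _≤S_ : Elem → Elem → Set where
    refl≤ : ∀ s → s ≤S s
    to𝟘   : ∀ s → s ≤S 𝟘
    gen₁  : ∀ i → ab (succ i) ≤S a i
    gen₂  : ∀ i → a i ≤S ac (succ i)
    gen₃  : ∀ i → ab i ≤S ac i

  𝒮 : LCStructure
  𝒮 = record { Carrier = Elem ; _≤_ = _≤S_ ; _∘_ = _∙_ }

{- 𝒮ₙ is the quotient, by i ↦ i mod N, of the structure 𝒵 with elements 0, b, c, aᵢ, aᵢb, aᵢc for i ∈ ℤ
   and the same generating order; 𝒵 is representable by relations on points pₘ, qⱼ, uⱼ, wⱼ.

   Not representable: in a representation of 𝒮ₙ, a_{i+1}b ⊑ aᵢ gives dom aᵢ ⊆ dom a_{i+1}. Going once around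
   the cycle of length N shows 0 ⊑ a₁c, while 0 ≰ a₁c.

   σₖ for k < n: by induction on k, every instance of b ◀ₖ a lifts to 𝒵 with dom b̃ ⊆ dom ã, and every instance
   of a ◁ᵇₖ c lifts with ã restricted to dom b̃ contained in c̃; along the way lifted indices move by at most 2ᵏ.
   In the premise of σₖ both lifts of b are then within 2ᵏ < N of each other, hence equal; so ã ⊑ b̃ in 𝒵,
   which projects to a ≤ b. -}

module Submission where

open import Defs
open import Level using (Level)
open import Data.Empty using (⊥; ⊥-elim)
open import Data.Fin using (Fin; toℕ; fromℕ<) renaming (zero to fz)
open import Data.Fin.Properties using (toℕ-injective; toℕ-fromℕ<; toℕ<n)
open import Data.Integer as ℤ using (ℤ; +_; ∣_∣; 0ℤ; 1ℤ)
import Data.Integer.Properties as ℤP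
open import Data.Integer.Tactic.RingSolver using (solve-∀)
open import Data.Nat as ℕ using (ℕ; zero; suc; _^_; _≤_; _<_; z≤n; s≤s)
open import Data.Nat.DivMod using (_%_; m<n⇒m%n≡m; n%n≡0)
import Data.Nat.Properties as ℕP
open import Data.Product using (Σ; ∃-syntax; _×_; _,_; proj₁; proj₂)
open import Data.Sum using (_⊎_; inj₁; inj₂) renaming (map to ⊎-map)
open import Relation.Binary.PropositionalEquality
  using (_≡_; _≢_; refl; sym; trans; cong; subst; subst₂; module ≡-Reasoning)
open import Relation.Nullary using (¬_)

module NotRepresentable (n : ℕ) {ℓ : Level} (ρ : Representation ℓ (Sn.𝒮 n)) where
  open Sn n
  open Representation ρ

  _⊆ᵈ_ : Elem → Elem → Set ℓ
  s ⊆ᵈ t = ∀ x → dom (θ s) x → dom (θ t) x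

  ∘⇒⨾ : ∀ s t {x y} → θ (s ∙ t) x y → (θ s ⨾ θ t) x y
  ∘⇒⨾ s t = proj₁ (hom-∘ s t _ _)

  ⨾⇒∘ : ∀ s t {x y} → (θ s ⨾ θ t) x y → θ (s ∙ t) x y
  ⨾⇒∘ s t = proj₂ (hom-∘ s t _ _)

  dom-∙ : ∀ s t → (s ∙ t) ⊆ᵈ s
  dom-∙ s t x (y , h) = let (z , h₁ , _) = ∘⇒⨾ s t h in z , h₁

  ≤⇒⊇ᵈ : ∀ {s t} → s ≤S t → t ⊆ᵈ s
  ≤⇒⊇ᵈ {s} {t} s≤t = proj₁ (≤→⊑ s t s≤t)

  ≤⇒restricted⊆ : ∀ {s t} → s ≤S t → ∀ {x y} → dom (θ t) x → θ s x y → θ t x y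
  ≤⇒restricted⊆ {s} {t} s≤t = proj₂ (≤→⊑ s t s≤t) _ _

  dom-a⊆dom-a-succ : ∀ i → a i ⊆ᵈ a (succ i)
  dom-a⊆dom-a-succ i x x∈ = dom-∙ (a (succ i)) b x (≤⇒⊇ᵈ (gen₁ i) x x∈)

  succ-fromℕ< : ∀ {k} (k+1<N : suc k < N) → succ (fromℕ< (ℕP.<⇒≤ k+1<N)) ≡ fromℕ< k+1<N
  succ-fromℕ< {k} k+1<N = toℕ-injective (begin
    toℕ (succ (fromℕ< (ℕP.<⇒≤ k+1<N)))  ≡⟨ toℕ-fromℕ< _ ⟩
    suc (toℕ (fromℕ< _)) % N            ≡⟨ cong (λ v → suc v % N) (toℕ-fromℕ< _) ⟩
    suc k % N                           ≡⟨ m<n⇒m%n≡m k+1<N ⟩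
    suc k                               ≡⟨ toℕ-fromℕ< k+1<N ⟨
    toℕ (fromℕ< k+1<N)                  ∎)
    where open ≡-Reasoning

  dom-a₀⊆dom-a : ∀ k (k<N : k < N) → a fz ⊆ᵈ a (fromℕ< k<N)
  dom-a₀⊆dom-a zero    _     x x∈ = x∈
  dom-a₀⊆dom-a (suc k) k+1<N x x∈ =
    subst (λ i → dom (θ (a i)) x) (succ-fromℕ< k+1<N)
      (dom-a⊆dom-a-succ _ x (dom-a₀⊆dom-a k (ℕP.<⇒≤ k+1<N) x x∈))

  last : Fin N
  last = fromℕ< (ℕP.n<1+n (2 ^ n))

  succ-last : succ last ≡ fz
  succ-last = toℕ-injective (trans (toℕ-fromℕ< _)
    (trans (cong (λ v → suc v % N) (toℕ-fromℕ< (ℕP.n<1+n (2 ^ n)))) (n%n≡0 N)))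

  one : Fin N
  one = succ fz

  -- Around the cycle: dom a₁c ⊆ dom a₀ ⊆ dom a₁ ⊆ ⋯ ⊆ dom a_{N-1} ⊆ dom a₀b,
  -- and on dom a₁c the relation a₀ is contained in a₁c.
  dom-a₁c⊆dom-𝟘 : ∀ x → dom (θ (ac one)) x → dom (θ 𝟘) x
  dom-a₁c⊆dom-𝟘 x x∈ =
    let x∈a₀ = ≤⇒⊇ᵈ (gen₂ fz) x x∈
        x∈a₀b = subst (λ i → dom (θ (ab i)) x) succ-last
                  (≤⇒⊇ᵈ (gen₁ last) x (dom-a₀⊆dom-a (2 ^ n) (ℕP.n<1+n (2 ^ n)) x x∈a₀))
        (y , a₀b-xy) = x∈a₀b
        (v , a₀-xv , b-vy) = ∘⇒⨾ (a fz) b a₀b-xy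
    in y , ⨾⇒∘ (ac one) b (v , ≤⇒restricted⊆ (gen₂ fz) x∈ a₀-xv , b-vy)

  𝟘-restricted⊆a₁c : ∀ x y → dom (θ (ac one)) x → θ 𝟘 x y → θ (ac one) x y
  𝟘-restricted⊆a₁c x y x∈ 𝟘-xy =
    let (z , a₂b-xz , b-zy) = ∘⇒⨾ (ab (succ one)) b 𝟘-xy
        a₁-xz = ≤⇒restricted⊆ (gen₁ one) (dom-∙ (a one) c x x∈) a₂b-xz
    in ≤⇒restricted⊆ (gen₃ one) x∈ (⨾⇒∘ (a one) b (z , a₁-xz , b-zy))

  absurd : ⊥
  absurd with ⊑→≤ 𝟘 (ac one) (dom-a₁c⊆dom-𝟘 , 𝟘-restricted⊆a₁c)
  ... | ()

¬representable : ∀ ℓ n → ¬ Representable ℓ (Sn.𝒮 n)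
¬representable ℓ n ρ = NotRepresentable.absurd n ρ

∣kN∣<N⇒kN≡0 : ∀ N k → ∣ k ℤ.* + N ∣ ℕ.< N → k ℤ.* + N ≡ 0ℤ
∣kN∣<N⇒kN≡0 N k small = cong (ℤ._* + N) (ℤP.∣i∣≡0⇒i≡0 {k} (ℕP.n<1⇒n≡0 ∣k∣<1))
  where
  ∣k∣<1 : ∣ k ∣ ℕ.< 1
  ∣k∣<1 = ℕP.*-cancelʳ-< N ∣ k ∣ 1 (subst₂ ℕ._<_ (ℤP.abs-* k (+ N)) (sym (ℕP.*-identityˡ N)) small)

≡-mod-close : ∀ N i j k → i ℤ.- j ≡ k ℤ.* + N → ∣ i ℤ.- j ∣ ℕ.< N → i ≡ j
≡-mod-close N i j k i-j≡kN small =
  ℤP.i-j≡0⇒i≡j i j (trans i-j≡kN (∣kN∣<N⇒kN≡0 N k (subst (λ v → ∣ v ∣ ℕ.< N) i-j≡kN small)))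

∣i-k∣≤∣i-j∣+∣j-k∣ : ∀ i j k → ∣ i ℤ.- k ∣ ℕ.≤ ∣ i ℤ.- j ∣ ℕ.+ ∣ j ℤ.- k ∣
∣i-k∣≤∣i-j∣+∣j-k∣ i j k = subst (λ v → ∣ v ∣ ℕ.≤ ∣ i ℤ.- j ∣ ℕ.+ ∣ j ℤ.- k ∣)
  (ℤP.+-minus-telescope i j k) (ℤP.∣i+j∣≤∣i∣+∣j∣ (i ℤ.- j) (j ℤ.- k))

∣i-i∣≡0 : ∀ i → ∣ i ℤ.- i ∣ ≡ 0
∣i-i∣≡0 i = cong ∣_∣ (ℤP.+-inverseʳ i)

∣suc[i]-i∣≡1 : ∀ i → ∣ ℤ.suc i ℤ.- i ∣ ≡ 1
∣suc[i]-i∣≡1 i = cong ∣_∣ (suc[i]-i≡1 i)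
  where
  suc[i]-i≡1 : ∀ i → (1ℤ ℤ.+ i) ℤ.- i ≡ 1ℤ
  suc[i]-i≡1 = solve-∀

∣i-pred[i]∣≡1 : ∀ i → ∣ i ℤ.- ℤ.pred i ∣ ≡ 1
∣i-pred[i]∣≡1 i = cong ∣_∣ (i-pred[i]≡1 i)
  where
  i-pred[i]≡1 : ∀ i → i ℤ.- (ℤ.- 1ℤ ℤ.+ i) ≡ 1ℤ
  i-pred[i]≡1 = solve-∀

≤⇒<suc : ∀ {m i} → m ℤ.≤ i → m ℤ.< ℤ.suc i
≤⇒<suc m≤i = ℤP.suc[i]≤j⇒i<j (ℤP.suc-mono m≤i)

suc≡⇒< : ∀ {m i} → ℤ.suc m ≡ i → m ℤ.< i
suc≡⇒< refl = ≤⇒<suc ℤP.≤-refl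

suc-injective : ∀ {m i} → ℤ.suc m ≡ ℤ.suc i → m ≡ i
suc-injective {m} {i} e = trans (sym (ℤP.pred-suc m)) (trans (cong ℤ.pred e) (ℤP.pred-suc i))

pred[i]<i : ∀ i → ℤ.pred i ℤ.< i
pred[i]<i i = ℤP.i≤pred[j]⇒i<j ℤP.≤-refl

pred[i]<suc[i] : ∀ i → ℤ.pred i ℤ.< ℤ.suc i
pred[i]<suc[i] i = ℤP.<-trans (pred[i]<i i) (≤⇒<suc ℤP.≤-refl)

pred[pred[i]]<i : ∀ i → ℤ.pred (ℤ.pred i) ℤ.< i
pred[pred[i]]<i i = ℤP.<-trans (pred[i]<i (ℤ.pred i)) (pred[i]<i i)

pred[i]≢i : ∀ i → ℤ.pred i ≢ i
pred[i]≢i i e = ℤP.<-irrefl e (pred[i]<i i)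

data Kind : Set where
  ka kab kac : Kind

data Cover : Set where
  𝟘ᶻ bᶻ cᶻ : Cover
  ix : Kind → ℤ → Cover

Indexed : Cover → Set
Indexed x = ∃[ k ] ∃[ i ] x ≡ ix k i

data Point : Set where
  p q u w : ℤ → Point

θa : ℤ → Point → Point → Set
θa i s t = (Σ ℤ λ m → s ≡ p m × m ℤ.≤ i × t ≡ w (ℤ.suc i))
         ⊎ (Σ ℤ λ m → s ≡ p m × m ℤ.< i × t ≡ q i)
         ⊎ (Σ ℤ λ m → s ≡ p m × ℤ.suc m ≡ i × t ≡ u i)

θb : Point → Point → Set
θb s t = Σ ℤ λ j → s ≡ q j × t ≡ w j

θc : Point → Point → Set
θc s t = Σ ℤ λ j → s ≡ u j × t ≡ w j

-- In this representation aᵢ b = {(pₘ, wᵢ) | m < i} and aᵢ c = {(p_{i-1}, wᵢ)}.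
θᶻ : Cover → Point → Point → Set
θᶻ 𝟘ᶻ _ _ = ⊥
θᶻ bᶻ = θb
θᶻ cᶻ = θc
θᶻ (ix ka i) = θa i
θᶻ (ix kab i) = θa i ⨾ θb
θᶻ (ix kac i) = θa i ⨾ θc

_∘ᶻ_ : Cover → Cover → Cover
ix ka i ∘ᶻ bᶻ = ix kab i
ix ka i ∘ᶻ cᶻ = ix kac i
_ ∘ᶻ _ = 𝟘ᶻ

¬into-p : ∀ x s m → θᶻ x s (p m) → ⊥
¬into-p 𝟘ᶻ s m ()
¬into-p bᶻ s m (_ , _ , ())
¬into-p cᶻ s m (_ , _ , ())
¬into-p (ix ka i) s m (inj₁ (_ , _ , _ , ()))
¬into-p (ix ka i) s m (inj₂ (inj₁ (_ , _ , _ , ())))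
¬into-p (ix ka i) s m (inj₂ (inj₂ (_ , _ , _ , ())))
¬into-p (ix kab i) s m (_ , _ , _ , _ , ())
¬into-p (ix kac i) s m (_ , _ , _ , _ , ())

into-q⇒a : ∀ x s j → θᶻ x s (q j) → ∃[ i ] x ≡ ix ka i
into-q⇒a 𝟘ᶻ s j ()
into-q⇒a bᶻ s j (_ , _ , ())
into-q⇒a cᶻ s j (_ , _ , ())
into-q⇒a (ix ka i) s j _ = i , refl
into-q⇒a (ix kab i) s m (_ , _ , _ , _ , ())
into-q⇒a (ix kac i) s m (_ , _ , _ , _ , ())

into-u⇒a : ∀ x s j → θᶻ x s (u j) → ∃[ i ] x ≡ ix ka i
into-u⇒a 𝟘ᶻ s j ()
into-u⇒a bᶻ s j (_ , _ , ())
into-u⇒a cᶻ s j (_ , _ , ())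
into-u⇒a (ix ka i) s j _ = i , refl
into-u⇒a (ix kab i) s m (_ , _ , _ , _ , ())
into-u⇒a (ix kac i) s m (_ , _ , _ , _ , ())

data Source : Cover → Point → Set where
  from-p : ∀ k i m → Source (ix k i) (p m)
  from-q : ∀ j → Source bᶻ (q j)
  from-u : ∀ j → Source cᶻ (u j)

source : ∀ x s t → θᶻ x s t → Source x s
source 𝟘ᶻ s t ()
source bᶻ s t (j , refl , _) = from-q j
source cᶻ s t (j , refl , _) = from-u j
source (ix ka i) s t (inj₁ (m , refl , _)) = from-p ka i m
source (ix ka i) s t (inj₂ (inj₁ (m , refl , _))) = from-p ka i m
source (ix ka i) s t (inj₂ (inj₂ (m , refl , _))) = from-p ka i m
source (ix kab i) s t (_ , inj₁ (m , refl , _) , _) = from-p kab i m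
source (ix kab i) s t (_ , inj₂ (inj₁ (m , refl , _)) , _) = from-p kab i m
source (ix kab i) s t (_ , inj₂ (inj₂ (m , refl , _)) , _) = from-p kab i m
source (ix kac i) s t (_ , inj₁ (m , refl , _) , _) = from-p kac i m
source (ix kac i) s t (_ , inj₂ (inj₁ (m , refl , _)) , _) = from-p kac i m
source (ix kac i) s t (_ , inj₂ (inj₂ (m , refl , _)) , _) = from-p kac i m

∘ᶻ⇒⨾ : ∀ x y s t → θᶻ (x ∘ᶻ y) s t → (θᶻ x ⨾ θᶻ y) s t
∘ᶻ⇒⨾ (ix ka i) bᶻ s t h = h
∘ᶻ⇒⨾ (ix ka i) cᶻ s t h = h
∘ᶻ⇒⨾ 𝟘ᶻ y s t ()
∘ᶻ⇒⨾ bᶻ y s t ()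
∘ᶻ⇒⨾ cᶻ y s t ()
∘ᶻ⇒⨾ (ix kab i) y s t ()
∘ᶻ⇒⨾ (ix kac i) y s t ()
∘ᶻ⇒⨾ (ix ka i) 𝟘ᶻ s t ()
∘ᶻ⇒⨾ (ix ka i) (ix k j) s t ()

⨾⇒∘ᶻ : ∀ x y s t → (θᶻ x ⨾ θᶻ y) s t → θᶻ (x ∘ᶻ y) s t
⨾⇒∘ᶻ x y s t (m , x-sm , y-mt) with source y m t y-mt
⨾⇒∘ᶻ x (ix k j) s t (.(p m) , x-sm , _) | from-p _ _ m = ⊥-elim (¬into-p x s m x-sm)
⨾⇒∘ᶻ x bᶻ s t (.(q j) , x-sm , y-mt) | from-q j with into-q⇒a x s j x-sm
... | _ , refl = q j , x-sm , y-mt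
⨾⇒∘ᶻ x cᶻ s t (.(u j) , x-sm , y-mt) | from-u j with into-u⇒a x s j x-sm
... | _ , refl = u j , x-sm , y-mt

a↦w : ∀ {m i} → m ℤ.≤ i → θa i (p m) (w (ℤ.suc i))
a↦w m≤i = inj₁ (_ , refl , m≤i , refl)

a↦q : ∀ {m i} → m ℤ.< i → θa i (p m) (q i)
a↦q m<i = inj₂ (inj₁ (_ , refl , m<i , refl))

ab↦w : ∀ {m i} → m ℤ.< i → (θa i ⨾ θb) (p m) (w i)
ab↦w m<i = q _ , a↦q m<i , (_ , refl , refl)

ac↦w : ∀ {m i} → ℤ.suc m ≡ i → (θa i ⨾ θc) (p m) (w i)
ac↦w 1+m≡i = u _ , inj₂ (inj₂ (_ , refl , 1+m≡i , refl)) , (_ , refl , refl)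

dom-a : ∀ i v → dom (θa i) v → ∃[ m ] v ≡ p m × m ℤ.≤ i
dom-a i v (_ , inj₁ (m , refl , m≤i , _)) = m , refl , m≤i
dom-a i v (_ , inj₂ (inj₁ (m , refl , m<i , _))) = m , refl , ℤP.<⇒≤ m<i
dom-a i v (_ , inj₂ (inj₂ (m , refl , 1+m≡i , _))) = m , refl , ℤP.<⇒≤ (suc≡⇒< 1+m≡i)

ab-inv : ∀ {i v v′} → (θa i ⨾ θb) v v′ → ∃[ m ] v ≡ p m × m ℤ.< i × v′ ≡ w i
ab-inv (_ , inj₁ (_ , _ , _ , refl) , (_ , () , _))
ab-inv (_ , inj₂ (inj₂ (_ , _ , _ , refl)) , (_ , () , _))
ab-inv (_ , inj₂ (inj₁ (m , refl , m<i , refl)) , (_ , refl , refl)) = m , refl , m<i , refl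

ac-inv : ∀ {i v v′} → (θa i ⨾ θc) v v′ → ∃[ m ] v ≡ p m × ℤ.suc m ≡ i × v′ ≡ w i
ac-inv (_ , inj₁ (_ , _ , _ , refl) , (_ , () , _))
ac-inv (_ , inj₂ (inj₁ (_ , _ , _ , refl)) , (_ , () , _))
ac-inv (_ , inj₂ (inj₂ (m , refl , 1+m≡i , refl)) , (_ , refl , refl)) = m , refl , 1+m≡i , refl

a-into-w : ∀ {i v l} → θa i v (w l) → l ≡ ℤ.suc i
a-into-w (inj₁ (_ , _ , _ , refl)) = refl
a-into-w (inj₂ (inj₁ (_ , _ , _ , ())))
a-into-w (inj₂ (inj₂ (_ , _ , _ , ())))

pred∈dom : ∀ k j → dom (θᶻ (ix k j)) (p (ℤ.pred j))
pred∈dom ka j = w (ℤ.suc j) , a↦w (ℤP.<⇒≤ (pred[i]<i j))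
pred∈dom kab j = w j , ab↦w (pred[i]<i j)
pred∈dom kac j = w j , ac↦w (ℤP.suc-pred j)

dom-p⇒ix : ∀ x m → dom (θᶻ x) (p m) → Indexed x
dom-p⇒ix x m (v , x-pv) with source x (p m) v x-pv
... | from-p k i .m = k , i , refl

dom-q⇒b : ∀ x j → dom (θᶻ x) (q j) → x ≡ bᶻ
dom-q⇒b x j (v , x-qv) with source x (q j) v x-qv
... | from-q .j = refl

dom-u⇒c : ∀ x j → dom (θᶻ x) (u j) → x ≡ cᶻ
dom-u⇒c x j (v , x-uv) with source x (u j) v x-uv
... | from-u .j = refl

data _≤ᶻ_ : Cover → Cover → Set where
  refl≤ᶻ : ∀ x → x ≤ᶻ x
  to𝟘ᶻ   : ∀ x → x ≤ᶻ 𝟘ᶻ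
  gen₁ᶻ  : ∀ i → ix kab (ℤ.suc i) ≤ᶻ ix ka i
  gen₂ᶻ  : ∀ i → ix ka i ≤ᶻ ix kac (ℤ.suc i)
  gen₃ᶻ  : ∀ i → ix kab i ≤ᶻ ix kac i

gen₁-⊑ : ∀ i → θᶻ (ix kab (ℤ.suc i)) ⊑ θᶻ (ix ka i)
gen₁-⊑ i = domains , restriction
  where
  domains : ∀ v → dom (θa i) v → dom (θa (ℤ.suc i) ⨾ θb) v
  domains v v∈a with dom-a i v v∈a
  ... | _ , refl , m≤i = w (ℤ.suc i) , ab↦w (≤⇒<suc m≤i)
  restriction : ∀ v v′ → dom (θa i) v → (θa (ℤ.suc i) ⨾ θb) v v′ → θa i v v′
  restriction v v′ v∈a ab-vv′ with dom-a i v v∈a | ab-inv ab-vv′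
  ... | _ , refl , m≤i | _ , refl , _ , refl = a↦w m≤i

gen₂-⊑ : ∀ i → θᶻ (ix ka i) ⊑ θᶻ (ix kac (ℤ.suc i))
gen₂-⊑ i = domains , restriction
  where
  domains : ∀ v → dom (θa (ℤ.suc i) ⨾ θc) v → dom (θa i) v
  domains v (_ , ac-vv′) with ac-inv ac-vv′
  ... | m , refl , 1+m≡1+i , _ with suc-injective {m} {i} 1+m≡1+i
  ...   | refl = w (ℤ.suc i) , a↦w ℤP.≤-refl
  restriction : ∀ v v′ → dom (θa (ℤ.suc i) ⨾ θc) v → θa i v v′ → (θa (ℤ.suc i) ⨾ θc) v v′
  restriction v v′ (_ , ac-vv″) a-vv′ with ac-inv ac-vv″
  ... | m , refl , 1+m≡1+i , _ with suc-injective {m} {i} 1+m≡1+i | a-vv′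
  ...   | refl | inj₁ (_ , refl , _ , refl) = ac↦w refl
  ...   | refl | inj₂ (inj₁ (_ , refl , i<i , _)) = ⊥-elim (ℤP.<-irrefl refl i<i)
  ...   | refl | inj₂ (inj₂ (_ , refl , 1+i≡i , _)) = ⊥-elim (ℤP.i≢suc[i] (sym 1+i≡i))

gen₃-⊑ : ∀ i → θᶻ (ix kab i) ⊑ θᶻ (ix kac i)
gen₃-⊑ i = domains , restriction
  where
  domains : ∀ v → dom (θa i ⨾ θc) v → dom (θa i ⨾ θb) v
  domains v (_ , ac-vv′) with ac-inv ac-vv′
  ... | _ , refl , 1+m≡i , _ = w i , ab↦w (suc≡⇒< 1+m≡i)
  restriction : ∀ v v′ → dom (θa i ⨾ θc) v → (θa i ⨾ θb) v v′ → (θa i ⨾ θc) v v′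
  restriction v v′ (_ , ac-vv″) ab-vv′ with ac-inv ac-vv″ | ab-inv ab-vv′
  ... | _ , refl , 1+m≡i , _ | _ , refl , _ , refl = ac↦w 1+m≡i

≤ᶻ⇒⊑ : ∀ {x y} → x ≤ᶻ y → θᶻ x ⊑ θᶻ y
≤ᶻ⇒⊑ (refl≤ᶻ x) = (λ _ v∈x → v∈x) , (λ _ _ _ x-vv′ → x-vv′)
≤ᶻ⇒⊑ (to𝟘ᶻ x) = (λ _ ()) , (λ _ _ ())
≤ᶻ⇒⊑ (gen₁ᶻ i) = gen₁-⊑ i
≤ᶻ⇒⊑ (gen₂ᶻ i) = gen₂-⊑ i
≤ᶻ⇒⊑ (gen₃ᶻ i) = gen₃-⊑ i

-- Test on the point p (j − 1), which lies in the domain of every element of index j;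
-- where x̃ sends it recovers the kind and index of x̃.
⊑⇒≤ᶻ-ix : ∀ k′ i k j → θᶻ (ix k′ i) ⊑ θᶻ (ix k j) → ix k′ i ≤ᶻ ix k j
⊑⇒≤ᶻ-ix ka i k j (dom⊇ , agree) with dom-a i _ (dom⊇ _ (pred∈dom k j))
⊑⇒≤ᶻ-ix ka i ka j (_ , agree) | _ , refl , j-1≤i
  with suc-injective {i} {j} (a-into-w (agree _ _ (pred∈dom ka j) (a↦w j-1≤i)))
... | refl = refl≤ᶻ _
⊑⇒≤ᶻ-ix ka i kab j (_ , agree) | _ , refl , j-1≤i
  with ab-inv (agree _ _ (pred∈dom kab j) (a↦w j-1≤i))
... | _ , _ , _ , refl with ab-inv (agree _ _ (w (ℤ.suc i) , ab↦w (pred[i]<suc[i] i)) (a↦q (pred[i]<i i)))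
...   | _ , _ , _ , ()
⊑⇒≤ᶻ-ix ka i kac j (_ , agree) | _ , refl , j-1≤i
  with ac-inv (agree _ _ (pred∈dom kac j) (a↦w j-1≤i))
... | _ , _ , _ , refl = gen₂ᶻ i
⊑⇒≤ᶻ-ix kab i k j (dom⊇ , agree) with ab-inv (proj₂ (dom⊇ _ (pred∈dom k j)))
⊑⇒≤ᶻ-ix kab i ka j (_ , agree) | _ , refl , j-1<i , _
  with a-into-w (agree _ _ (pred∈dom ka j) (ab↦w j-1<i))
... | refl = gen₁ᶻ j
⊑⇒≤ᶻ-ix kab i kab j (_ , agree) | _ , refl , j-1<i , _
  with ab-inv (agree _ _ (pred∈dom kab j) (ab↦w j-1<i))
... | _ , _ , _ , refl = refl≤ᶻ _
⊑⇒≤ᶻ-ix kab i kac j (_ , agree) | _ , refl , j-1<i , _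
  with ac-inv (agree _ _ (pred∈dom kac j) (ab↦w j-1<i))
... | _ , _ , _ , refl = gen₃ᶻ j
⊑⇒≤ᶻ-ix kac i k j (dom⊇ , _) with ac-inv (proj₂ (dom⊇ _ (pred∈dom k j)))
... | _ , refl , 1+[j-1]≡i , _ with trans (sym (ℤP.suc-pred j)) 1+[j-1]≡i
⊑⇒≤ᶻ-ix kac i kac j _ | _ | refl = refl≤ᶻ _
⊑⇒≤ᶻ-ix kac i ka j (dom⊇ , _) | _ | refl
  with ac-inv (proj₂ (dom⊇ _ (w (ℤ.suc j) , a↦w (ℤP.<⇒≤ (pred[pred[i]]<i j)))))
... | _ , refl , j-1≡j , _ = ⊥-elim (pred[i]≢i j (trans (sym (ℤP.suc-pred (ℤ.pred j))) j-1≡j))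
⊑⇒≤ᶻ-ix kac i kab j (dom⊇ , _) | _ | refl
  with ac-inv (proj₂ (dom⊇ _ (w j , ab↦w (pred[pred[i]]<i j))))
... | _ , refl , j-1≡j , _ = ⊥-elim (pred[i]≢i j (trans (sym (ℤP.suc-pred (ℤ.pred j))) j-1≡j))

⊑⇒≤ᶻ : ∀ x y → θᶻ x ⊑ θᶻ y → x ≤ᶻ y
⊑⇒≤ᶻ x 𝟘ᶻ _ = to𝟘ᶻ x
⊑⇒≤ᶻ x bᶻ (dom⊇ , _) with dom-q⇒b x 0ℤ (dom⊇ (q 0ℤ) (w 0ℤ , 0ℤ , refl , refl))
... | refl = refl≤ᶻ bᶻ
⊑⇒≤ᶻ x cᶻ (dom⊇ , _) with dom-u⇒c x 0ℤ (dom⊇ (u 0ℤ) (w 0ℤ , 0ℤ , refl , refl))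
... | refl = refl≤ᶻ cᶻ
⊑⇒≤ᶻ x (ix k j) x⊑y@(dom⊇ , _) with dom-p⇒ix x (ℤ.pred j) (dom⊇ _ (pred∈dom k j))
... | k′ , i , refl = ⊑⇒≤ᶻ-ix k′ i k j x⊑y

≤ᶻ𝟘 : ∀ {x} → 𝟘ᶻ ≤ᶻ x → x ≡ 𝟘ᶻ
≤ᶻ𝟘 (refl≤ᶻ _) = refl
≤ᶻ𝟘 (to𝟘ᶻ _) = refl

dom-empty⇒𝟘 : ∀ x → (∀ v → dom (θᶻ x) v → ⊥) → x ≡ 𝟘ᶻ
dom-empty⇒𝟘 𝟘ᶻ _ = refl
dom-empty⇒𝟘 bᶻ empty = ⊥-elim (empty (q 0ℤ) (w 0ℤ , 0ℤ , refl , refl))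
dom-empty⇒𝟘 cᶻ empty = ⊥-elim (empty (u 0ℤ) (w 0ℤ , 0ℤ , refl , refl))
dom-empty⇒𝟘 (ix k i) empty = ⊥-elim (empty _ (pred∈dom k i))

is-𝟘ᶻ : ∀ x → x ≡ 𝟘ᶻ ⊎ x ≢ 𝟘ᶻ
is-𝟘ᶻ 𝟘ᶻ = inj₁ refl
is-𝟘ᶻ bᶻ = inj₂ λ ()
is-𝟘ᶻ cᶻ = inj₂ λ ()
is-𝟘ᶻ (ix _ _) = inj₂ λ ()

record Dom⊆ (x y : Cover) : Set where
  constructor mkDom⊆
  field dom-mono : ∀ v → dom (θᶻ x) v → dom (θᶻ y) v
open Dom⊆

record Restr⊆ (s x y : Cover) : Set where
  constructor mkRestr⊆
  field restr-mono : ∀ v v′ → dom (θᶻ s) v → θᶻ x v v′ → θᶻ y v v′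
open Restr⊆

record RestrEmpty (s x : Cover) : Set where
  constructor mkRestrEmpty
  field restr-empty : ∀ v v′ → dom (θᶻ s) v → θᶻ x v v′ → ⊥
open RestrEmpty

≤ᶻ⇒Dom⊇ : ∀ {x y} → x ≤ᶻ y → Dom⊆ y x
≤ᶻ⇒Dom⊇ x≤y = mkDom⊆ (proj₁ (≤ᶻ⇒⊑ x≤y))

≤ᶻ⇒Restr⊆ : ∀ {x y} → x ≤ᶻ y → Restr⊆ y x y
≤ᶻ⇒Restr⊆ x≤y = mkRestr⊆ (proj₂ (≤ᶻ⇒⊑ x≤y))

Dom⊇-Restr⊆⇒≤ᶻ : ∀ {x y} → Dom⊆ y x → Restr⊆ y x y → x ≤ᶻ y
Dom⊇-Restr⊆⇒≤ᶻ {x} {y} y⊆x x⊆y = ⊑⇒≤ᶻ x y (dom-mono y⊆x , restr-mono x⊆y)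

Dom⊆-trans : ∀ {x y z} → Dom⊆ x y → Dom⊆ y z → Dom⊆ x z
Dom⊆-trans x⊆y y⊆z = mkDom⊆ λ v v∈x → dom-mono y⊆z v (dom-mono x⊆y v v∈x)

Dom⊆-𝟘 : ∀ {y} → Dom⊆ 𝟘ᶻ y
Dom⊆-𝟘 = mkDom⊆ λ { _ (_ , ()) }

Dom⊆-∘ : ∀ x y → Dom⊆ (x ∘ᶻ y) x
Dom⊆-∘ x y = mkDom⊆ λ { v (v′ , xy-vv′) → let (m , x-vm , _) = ∘ᶻ⇒⨾ x y v v′ xy-vv′ in m , x-vm }

Dom⊆-∘ʳ : ∀ x {y y′} → Dom⊆ y y′ → Dom⊆ (x ∘ᶻ y) (x ∘ᶻ y′)
Dom⊆-∘ʳ x {y} {y′} y⊆y′ = mkDom⊆ λ { v (v′ , xy-vv′) →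
  let (m , x-vm , y-mv′) = ∘ᶻ⇒⨾ x y v v′ xy-vv′
      (v″ , y′-mv″) = dom-mono y⊆y′ m (v′ , y-mv′)
  in v″ , ⨾⇒∘ᶻ x y′ v v″ (m , x-vm , y′-mv″) }

Dom⊆-Indexed : ∀ {x y} → Dom⊆ x y → ∀ {k i} → x ≡ ix k i → Indexed y
Dom⊆-Indexed {y = y} x⊆y {k} {i} refl = dom-p⇒ix y (ℤ.pred i) (dom-mono x⊆y _ (pred∈dom k i))

Dom⊆-Indexed⁻ : ∀ {x y} → x ≢ 𝟘ᶻ → Dom⊆ x y → ∀ {k j} → y ≡ ix k j → Indexed x
Dom⊆-Indexed⁻ {𝟘ᶻ} x≢𝟘 _ _ = ⊥-elim (x≢𝟘 refl)
Dom⊆-Indexed⁻ {bᶻ} {y} _ b⊆y y≡ix with dom-q⇒b y 0ℤ (dom-mono b⊆y (q 0ℤ) (w 0ℤ , 0ℤ , refl , refl)) | y≡ix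
... | refl | ()
Dom⊆-Indexed⁻ {cᶻ} {y} _ c⊆y y≡ix with dom-u⇒c y 0ℤ (dom-mono c⊆y (u 0ℤ) (w 0ℤ , 0ℤ , refl , refl)) | y≡ix
... | refl | ()
Dom⊆-Indexed⁻ {ix k i} _ _ _ = k , i , refl

Dom⊆-RestrEmpty⇒𝟘 : ∀ {s x} → Dom⊆ s x → RestrEmpty s x → s ≡ 𝟘ᶻ
Dom⊆-RestrEmpty⇒𝟘 {s} s⊆x empty = dom-empty⇒𝟘 s λ v v∈s →
  let (v′ , x-vv′) = dom-mono s⊆x v v∈s in restr-empty empty v v′ v∈s x-vv′

Restr⊆-self⇒Dom⊆ : ∀ {x y} → Restr⊆ x x y → Dom⊆ x y
Restr⊆-self⇒Dom⊆ x⊆y = mkDom⊆ λ { v (v′ , x-vv′) → v′ , restr-mono x⊆y v v′ (v′ , x-vv′) x-vv′ }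

Restr⊆-trans : ∀ {s x y z} → Restr⊆ s x y → Restr⊆ s y z → Restr⊆ s x z
Restr⊆-trans x⊆y y⊆z = mkRestr⊆ λ v v′ v∈s x-vv′ →
  restr-mono y⊆z v v′ v∈s (restr-mono x⊆y v v′ v∈s x-vv′)

Restr⊆-RestrEmpty : ∀ {s x y} → Restr⊆ s x y → RestrEmpty s y → RestrEmpty s x
Restr⊆-RestrEmpty x⊆y empty = mkRestrEmpty λ v v′ v∈s x-vv′ →
  restr-empty empty v v′ v∈s (restr-mono x⊆y v v′ v∈s x-vv′)

RestrEmpty⇒Restr⊆ : ∀ {s x y} → RestrEmpty s x → Restr⊆ s x y
RestrEmpty⇒Restr⊆ empty = mkRestr⊆ λ v v′ v∈s x-vv′ → ⊥-elim (restr-empty empty v v′ v∈s x-vv′)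

RestrEmpty-𝟘ˡ : ∀ {x} → RestrEmpty 𝟘ᶻ x
RestrEmpty-𝟘ˡ = mkRestrEmpty λ { _ _ (_ , ()) }

RestrEmpty-𝟘ʳ : ∀ {s} → RestrEmpty s 𝟘ᶻ
RestrEmpty-𝟘ʳ = mkRestrEmpty λ { _ _ _ () }

Restr⊆-∘ : ∀ {s x x′ y y′} → Restr⊆ s x x′ → Restr⊆ y y y′ → Restr⊆ s (x ∘ᶻ y) (x′ ∘ᶻ y′)
Restr⊆-∘ {x = x} {x′} {y} {y′} x⊆x′ y⊆y′ = mkRestr⊆ λ v v′ v∈s xy-vv′ →
  let (m , x-vm , y-mv′) = ∘ᶻ⇒⨾ x y v v′ xy-vv′
  in ⨾⇒∘ᶻ x′ y′ v v′ (m , restr-mono x⊆x′ v m v∈s x-vm , restr-mono y⊆y′ m v′ (v′ , y-mv′) y-mv′)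

RestrEmpty-∘ : ∀ {s x} y → RestrEmpty s x → RestrEmpty s (x ∘ᶻ y)
RestrEmpty-∘ {x = x} y empty = mkRestrEmpty λ v v′ v∈s xy-vv′ →
  let (m , x-vm , _) = ∘ᶻ⇒⨾ x y v v′ xy-vv′ in restr-empty empty v m v∈s x-vm

Restr⊆-Dom⊆ : ∀ {s s′ x y} → Dom⊆ s s′ → Restr⊆ s′ x y → Restr⊆ s x y
Restr⊆-Dom⊆ s⊆s′ x⊆y = mkRestr⊆ λ v v′ v∈s → restr-mono x⊆y v v′ (dom-mono s⊆s′ v v∈s)

RestrEmpty-Dom⊆ : ∀ {s s′ x} → Dom⊆ s s′ → RestrEmpty s′ x → RestrEmpty s x
RestrEmpty-Dom⊆ s⊆s′ empty = mkRestrEmpty λ v v′ v∈s → restr-empty empty v v′ (dom-mono s⊆s′ v v∈s)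

record Near (P : ℕ → Set) (x y : Cover) : Set where
  constructor mkNear
  field bound : ∀ {k i k′ j} → x ≡ ix k i → y ≡ ix k′ j → P ∣ i ℤ.- j ∣
open Near

Near-ix : ∀ {P k i k′ j} → P ∣ i ℤ.- j ∣ → Near P (ix k i) (ix k′ j)
Near-ix P-d = mkNear λ { refl refl → P-d }

Near-𝟘ˡ : ∀ {P y} → Near P 𝟘ᶻ y
Near-𝟘ˡ = mkNear λ ()

Near-mono : ∀ {P Q : ℕ → Set} {x y} → (∀ {d} → P d → Q d) → Near P x y → Near Q x y
Near-mono P⇒Q near = mkNear λ x≡ y≡ → P⇒Q (bound near x≡ y≡)

Near-refl : ∀ {P : ℕ → Set} {x} → P 0 → Near P x x
Near-refl {P} p₀ = mkNear λ { {i = i} refl refl → subst P (sym (∣i-i∣≡0 i)) p₀ }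

Near-sym : ∀ {P : ℕ → Set} {x y} → Near P x y → Near P y x
Near-sym {P} near = mkNear λ {_} {i} {_} {j} y≡ x≡ → subst P (ℤP.∣i-j∣≡∣j-i∣ j i) (bound near x≡ y≡)

Near-trans : ∀ {P Q R : ℕ → Set} {x y z} → (∀ {d₁ d₂ d} → d ℕ.≤ d₁ ℕ.+ d₂ → P d₁ → Q d₂ → R d) →
             (∀ {k i} → x ≡ ix k i → Indexed y) → Near P x y → Near Q y z → Near R x z
Near-trans {R = R} {x} {y} {z} combine y-indexed near₁ near₂ = mkNear through-y
  where
  through-y : ∀ {k i k′ j} → x ≡ ix k i → z ≡ ix k′ j → R ∣ i ℤ.- j ∣
  through-y {i = i} {j = j} x≡ z≡ with y-indexed x≡
  ... | _ , m , refl = combine (∣i-k∣≤∣i-j∣+∣j-k∣ i m j) (bound near₁ x≡ refl) (bound near₂ refl z≡)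

Near-kind : ∀ {P s k k′ i} → Near P s (ix k i) → Near P s (ix k′ i)
Near-kind near = mkNear λ { s≡ refl → bound near s≡ refl }

∘ᶻ-ix : ∀ x y {k j} → x ∘ᶻ y ≡ ix k j → x ≡ ix ka j
∘ᶻ-ix (ix ka i) bᶻ refl = refl
∘ᶻ-ix (ix ka i) cᶻ refl = refl
∘ᶻ-ix 𝟘ᶻ _ ()
∘ᶻ-ix bᶻ _ ()
∘ᶻ-ix cᶻ _ ()
∘ᶻ-ix (ix kab i) _ ()
∘ᶻ-ix (ix kac i) _ ()
∘ᶻ-ix (ix ka i) 𝟘ᶻ ()
∘ᶻ-ix (ix ka i) (ix _ _) ()

Near-∘ : ∀ {P s} x y → Near P s x → Near P s (x ∘ᶻ y)
Near-∘ x y near = mkNear λ s≡ xy≡ → bound near s≡ (∘ᶻ-ix x y xy≡)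

2^suc≡2^+2^ : ∀ k → 2 ^ suc k ≡ 2 ^ k ℕ.+ 2 ^ k
2^suc≡2^+2^ k = cong (2 ^ k ℕ.+_) (ℕP.+-identityʳ (2 ^ k))

2^≤2^suc : ∀ k → 2 ^ k ℕ.≤ 2 ^ suc k
2^≤2^suc k = ℕP.^-monoʳ-≤ 2 (ℕP.n≤1+n k)

module Lifting (n : ℕ) where
  open Sn n
  open Formulas 𝒮

  infix 4 _over_
  _over_ : ℤ → Fin N → Set
  z over i = ∃[ t ] z ≡ + toℕ i ℤ.+ t ℤ.* + N

  over-self : ∀ i → + toℕ i over i
  over-self i = 0ℤ , sym (ℤP.+-identityʳ (+ toℕ i))

  over-succ : ∀ {z i} → z over i → ℤ.suc z over succ i
  over-succ {i = i} (t , refl) with ℕP.m≤n⇒m<n∨m≡n (toℕ<n i)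
  ... | inj₁ i+1<N = t , (begin
    1ℤ ℤ.+ (+ toℕ i ℤ.+ t ℤ.* + N)   ≡⟨ ℤP.+-assoc 1ℤ (+ toℕ i) (t ℤ.* + N) ⟨
    + suc (toℕ i) ℤ.+ t ℤ.* + N      ≡⟨ cong (λ v → + v ℤ.+ t ℤ.* + N) (m<n⇒m%n≡m i+1<N) ⟨
    + (suc (toℕ i) % N) ℤ.+ t ℤ.* + N ≡⟨ cong (λ v → + v ℤ.+ t ℤ.* + N) (toℕ-fromℕ< _) ⟨
    + toℕ (succ i) ℤ.+ t ℤ.* + N     ∎)
    where open ≡-Reasoning
  ... | inj₂ i+1≡N = ℤ.suc t , (begin
    1ℤ ℤ.+ (+ toℕ i ℤ.+ t ℤ.* + N)     ≡⟨ ℤP.+-assoc 1ℤ (+ toℕ i) (t ℤ.* + N) ⟨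
    + suc (toℕ i) ℤ.+ t ℤ.* + N        ≡⟨ cong (λ v → + v ℤ.+ t ℤ.* + N) i+1≡N ⟩
    + N ℤ.+ t ℤ.* + N                  ≡⟨ ℤP.suc-* t (+ N) ⟨
    ℤ.suc t ℤ.* + N                    ≡⟨ ℤP.+-identityˡ _ ⟨
    0ℤ ℤ.+ ℤ.suc t ℤ.* + N             ≡⟨ cong (λ v → + v ℤ.+ ℤ.suc t ℤ.* + N) toℕ-succ-i≡0 ⟨
    + toℕ (succ i) ℤ.+ ℤ.suc t ℤ.* + N ∎)
    where
    open ≡-Reasoning
    toℕ-succ-i≡0 : toℕ (succ i) ≡ 0
    toℕ-succ-i≡0 = trans (toℕ-fromℕ< _) (trans (cong (_% N) i+1≡N) (n%n≡0 N))

  over-pred : ∀ {z i} → z over succ i → ℤ.pred z over i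
  over-pred {z} {i} (t , z≡) with over-succ (over-self i)
  ... | t₀ , 1+i≡ = t ℤ.- t₀ , (begin
    ℤ.pred z                                                          ≡⟨ cong ℤ.pred z≡ ⟩
    ℤ.pred (S ℤ.+ t ℤ.* + N)                                          ≡⟨ cong ℤ.pred (shift S t₀ t (+ N)) ⟩
    ℤ.pred ((S ℤ.+ t₀ ℤ.* + N) ℤ.+ (t ℤ.- t₀) ℤ.* + N)                ≡⟨ cong (λ v → ℤ.pred (v ℤ.+ (t ℤ.- t₀) ℤ.* + N)) 1+i≡ ⟨
    ℤ.pred ((1ℤ ℤ.+ + toℕ i) ℤ.+ (t ℤ.- t₀) ℤ.* + N)                  ≡⟨ cong ℤ.pred (ℤP.+-assoc 1ℤ (+ toℕ i) ((t ℤ.- t₀) ℤ.* + N)) ⟩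
    ℤ.pred (ℤ.suc (+ toℕ i ℤ.+ (t ℤ.- t₀) ℤ.* + N))                   ≡⟨ ℤP.pred-suc _ ⟩
    + toℕ i ℤ.+ (t ℤ.- t₀) ℤ.* + N                                    ∎)
    where
    open ≡-Reasoning
    S = + toℕ (succ i)
    shift : ∀ S t₀ t M → S ℤ.+ t ℤ.* M ≡ (S ℤ.+ t₀ ℤ.* M) ℤ.+ (t ℤ.- t₀) ℤ.* M
    shift = solve-∀

  over-unique : ∀ {z z' i} → z over i → z' over i → ∣ z ℤ.- z' ∣ ℕ.< N → z ≡ z'
  over-unique {i = i} (t , refl) (t' , refl) = ≡-mod-close N _ _ (t ℤ.- t') (difference (+ toℕ i) t t' (+ N))
    where
    difference : ∀ X t t' M → (X ℤ.+ t ℤ.* M) ℤ.- (X ℤ.+ t' ℤ.* M) ≡ (t ℤ.- t') ℤ.* M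
    difference = solve-∀

  over-functional : ∀ {z i j} → z over i → z over j → i ≡ j
  over-functional {z} {i} {j} (t , z≡i+tN) (t' , z≡j+t'N) =
    toℕ-injective (ℤP.+-injective (≡-mod-close N _ _ (t' ℤ.- t) i-j≡[t'-t]N ∣i-j∣<N))
    where
    difference : ∀ X Y t t' M → X ℤ.- Y ≡ ((X ℤ.+ t ℤ.* M) ℤ.- (Y ℤ.+ t' ℤ.* M)) ℤ.+ (t' ℤ.- t) ℤ.* M
    difference = solve-∀
    i-j≡[t'-t]N : + toℕ i ℤ.- + toℕ j ≡ (t' ℤ.- t) ℤ.* + N
    i-j≡[t'-t]N = trans (difference (+ toℕ i) (+ toℕ j) t t' (+ N))
      (trans (cong (ℤ._+ (t' ℤ.- t) ℤ.* + N) (ℤP.i≡j⇒i-j≡0 (trans (sym z≡i+tN) z≡j+t'N))) (ℤP.+-identityˡ _))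
    ∣i-j∣<N : ∣ + toℕ i ℤ.- + toℕ j ∣ ℕ.< N
    ∣i-j∣<N = subst (λ v → ∣ v ∣ ℕ.< N) (sym (ℤP.m-n≡m⊖n (toℕ i) (toℕ j)))
      (ℕP.≤-<-trans (ℤP.∣m⊝n∣≤m⊔n (toℕ i) (toℕ j)) (ℕP.⊔-lub (toℕ<n i) (toℕ<n j)))

  data Over : Cover → Elem → Set where
    o𝟘 : Over 𝟘ᶻ 𝟘
    ob : Over bᶻ b
    oc : Over cᶻ c
    oa : ∀ {z i} → z over i → Over (ix ka z) (a i)
    oab : ∀ {z i} → z over i → Over (ix kab z) (ab i)
    oac : ∀ {z i} → z over i → Over (ix kac z) (ac i)

  lift : ∀ x → Σ Cover λ x̃ → Over x̃ x
  lift 𝟘 = 𝟘ᶻ , o𝟘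
  lift b = bᶻ , ob
  lift c = cᶻ , oc
  lift (a i) = ix ka (+ toℕ i) , oa (over-self i)
  lift (ab i) = ix kab (+ toℕ i) , oab (over-self i)
  lift (ac i) = ix kac (+ toℕ i) , oac (over-self i)

  Over-𝟘 : ∀ {x̃} → Over x̃ 𝟘 → x̃ ≡ 𝟘ᶻ
  Over-𝟘 o𝟘 = refl

  Over-𝟘ᶻ : ∀ {x} → Over 𝟘ᶻ x → x ≡ 𝟘
  Over-𝟘ᶻ o𝟘 = refl

  Over-functional : ∀ {x̃ x y} → Over x̃ x → Over x̃ y → x ≡ y
  Over-functional o𝟘 o𝟘 = refl
  Over-functional ob ob = refl
  Over-functional oc oc = refl
  Over-functional (oa z/i) (oa z/j) = cong a (over-functional z/i z/j)
  Over-functional (oab z/i) (oab z/j) = cong ab (over-functional z/i z/j)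
  Over-functional (oac z/i) (oac z/j) = cong ac (over-functional z/i z/j)

  Over-unique : ∀ {x x̃ ỹ} → Over x̃ x → Over ỹ x → Near (ℕ._< N) x̃ ỹ → x̃ ≡ ỹ
  Over-unique o𝟘 o𝟘 _ = refl
  Over-unique ob ob _ = refl
  Over-unique oc oc _ = refl
  Over-unique (oa z/i) (oa z′/i) near = cong (ix ka) (over-unique z/i z′/i (bound near refl refl))
  Over-unique (oab z/i) (oab z′/i) near = cong (ix kab) (over-unique z/i z′/i (bound near refl refl))
  Over-unique (oac z/i) (oac z′/i) near = cong (ix kac) (over-unique z/i z′/i (bound near refl refl))

  Over-∘ : ∀ {x̃ ỹ x y} → Over x̃ x → Over ỹ y → Over (x̃ ∘ᶻ ỹ) (x ∙ y)
  Over-∘ o𝟘 _ = o𝟘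
  Over-∘ ob _ = o𝟘
  Over-∘ oc _ = o𝟘
  Over-∘ (oab _) _ = o𝟘
  Over-∘ (oac _) _ = o𝟘
  Over-∘ (oa _) o𝟘 = o𝟘
  Over-∘ (oa z/i) ob = oab z/i
  Over-∘ (oa z/i) oc = oac z/i
  Over-∘ (oa _) (oa _) = o𝟘
  Over-∘ (oa _) (oab _) = o𝟘
  Over-∘ (oa _) (oac _) = o𝟘

  Over-∙ : ∀ x y {x̃} → Over x̃ (x ∙ y) →
    x̃ ≡ 𝟘ᶻ ⊎ Σ Cover λ x̃₁ → Σ Cover λ x̃₂ →
      Over x̃₁ x × Over x̃₂ y × x̃ ≡ x̃₁ ∘ᶻ x̃₂ × (∀ {P s̃} → Near P s̃ x̃ → Near P s̃ x̃₁)
  Over-∙ (a i) b (oab {z} z/i) = inj₂ (ix ka z , bᶻ , oa z/i , ob , refl , Near-kind)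
  Over-∙ (a i) c (oac {z} z/i) = inj₂ (ix ka z , cᶻ , oa z/i , oc , refl , Near-kind)
  Over-∙ 𝟘 _ x̃/xy = inj₁ (Over-𝟘 x̃/xy)
  Over-∙ b _ x̃/xy = inj₁ (Over-𝟘 x̃/xy)
  Over-∙ c _ x̃/xy = inj₁ (Over-𝟘 x̃/xy)
  Over-∙ (ab _) _ x̃/xy = inj₁ (Over-𝟘 x̃/xy)
  Over-∙ (ac _) _ x̃/xy = inj₁ (Over-𝟘 x̃/xy)
  Over-∙ (a _) 𝟘 x̃/xy = inj₁ (Over-𝟘 x̃/xy)
  Over-∙ (a _) (a _) x̃/xy = inj₁ (Over-𝟘 x̃/xy)
  Over-∙ (a _) (ab _) x̃/xy = inj₁ (Over-𝟘 x̃/xy)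
  Over-∙ (a _) (ac _) x̃/xy = inj₁ (Over-𝟘 x̃/xy)

  ≤ᶻ⇒≤ : ∀ {x̃ ỹ x y} → x̃ ≤ᶻ ỹ → Over x̃ x → Over ỹ y → x ≤S y
  ≤ᶻ⇒≤ (refl≤ᶻ _) x̃/x x̃/y = subst (_ ≤S_) (Over-functional x̃/x x̃/y) (refl≤ _)
  ≤ᶻ⇒≤ (to𝟘ᶻ _) _ o𝟘 = to𝟘 _
  ≤ᶻ⇒≤ (gen₁ᶻ _) (oab z+1/j) (oa z/i) =
    subst (λ j → ab j ≤S _) (over-functional (over-succ z/i) z+1/j) (gen₁ _)
  ≤ᶻ⇒≤ (gen₂ᶻ _) (oa z/i) (oac z+1/j) =
    subst (λ j → _ ≤S ac j) (over-functional (over-succ z/i) z+1/j) (gen₂ _)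
  ≤ᶻ⇒≤ (gen₃ᶻ _) (oab z/i) (oac z/j) =
    subst (λ j → ab j ≤S _) (over-functional z/j z/i) (gen₃ _)

  lift-below : ∀ {x y x̃} → y ≤S x → Over x̃ x →
               Σ Cover λ ỹ → Over ỹ y × ỹ ≤ᶻ x̃ × Near (ℕ._≤ 1) x̃ ỹ
  lift-below (refl≤ _) x̃/x = _ , x̃/x , refl≤ᶻ _ , Near-refl z≤n
  lift-below (to𝟘 y) o𝟘 = proj₁ (lift y) , proj₂ (lift y) , to𝟘ᶻ _ , Near-𝟘ˡ
  lift-below (gen₁ _) (oa {z} z/i) =
    ix kab (ℤ.suc z) , oab (over-succ z/i) , gen₁ᶻ z ,
    Near-ix (ℕP.≤-reflexive (trans (ℤP.∣i-j∣≡∣j-i∣ z (ℤ.suc z)) (∣suc[i]-i∣≡1 z)))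
  lift-below (gen₂ _) (oac {z} z/i+1) =
    ix ka (ℤ.pred z) , oa (over-pred z/i+1) ,
    subst (λ j → ix ka (ℤ.pred z) ≤ᶻ ix kac j) (ℤP.suc-pred z) (gen₂ᶻ (ℤ.pred z)) ,
    Near-ix (ℕP.≤-reflexive (∣i-pred[i]∣≡1 z))
  lift-below (gen₃ _) (oac {z} z/i) =
    ix kab z , oab z/i , gen₃ᶻ z , Near-ix (subst (ℕ._≤ 1) (sym (∣i-i∣≡0 z)) z≤n)

  -- Slack leaves room for the index drift of the ◀-steps nested inside a ◁-derivation.
  AtMost Below Slack : ℕ → ℕ → Set
  AtMost k d = d ℕ.≤ 2 ^ k
  Below k d = d ℕ.< 2 ^ k
  Slack k d = d ℕ.+ 2 ^ k ℕ.≤ 2 ^ n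

  Slack⇒<N : ∀ k {d} → Slack k d → d ℕ.< N
  Slack⇒<N k {d} slack = s≤s (ℕP.≤-trans (ℕP.m≤m+n d (2 ^ k)) slack)

  Slack⇒∣suc[i]-j∣<N : ∀ k {i j} → Slack k ∣ i ℤ.- j ∣ → ∣ ℤ.suc i ℤ.- j ∣ ℕ.< N
  Slack⇒∣suc[i]-j∣<N k {i} {j} slack = s≤s (begin
    ∣ ℤ.suc i ℤ.- j ∣                ≤⟨ ∣i-k∣≤∣i-j∣+∣j-k∣ (ℤ.suc i) i j ⟩
    ∣ ℤ.suc i ℤ.- i ∣ ℕ.+ ∣ i ℤ.- j ∣ ≡⟨ cong (ℕ._+ ∣ i ℤ.- j ∣) (∣suc[i]-i∣≡1 i) ⟩
    1 ℕ.+ ∣ i ℤ.- j ∣                ≤⟨ ℕP.+-monoˡ-≤ ∣ i ℤ.- j ∣ (ℕP.^-monoʳ-≤ 2 {0} {k} z≤n) ⟩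
    2 ^ k ℕ.+ ∣ i ℤ.- j ∣            ≡⟨ ℕP.+-comm (2 ^ k) _ ⟩
    ∣ i ℤ.- j ∣ ℕ.+ 2 ^ k            ≤⟨ slack ⟩
    2 ^ n                            ∎)
    where open ℕP.≤-Reasoning

  Slack-suc⇒Slack : ∀ k {d} → Slack (suc k) d → Slack k d
  Slack-suc⇒Slack k {d} slack = ℕP.≤-trans (ℕP.+-monoʳ-≤ d (2^≤2^suc k)) slack

  AtMost⇒Slack : ∀ k {d} → 2 ^ suc k ℕ.≤ 2 ^ n → AtMost k d → Slack k d
  AtMost⇒Slack k 2^k+1≤2^n d≤2^k =
    ℕP.≤-trans (ℕP.+-monoˡ-≤ (2 ^ k) d≤2^k) (subst (ℕ._≤ 2 ^ n) (2^suc≡2^+2^ k) 2^k+1≤2^n)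

  Below⇒Slack : ∀ k {d} → 2 ^ suc k ℕ.≤ 2 ^ n → Below k d → Slack k d
  Below⇒Slack k 2^k+1≤2^n d<2^k = AtMost⇒Slack k 2^k+1≤2^n (ℕP.<⇒≤ d<2^k)

  Below⇒AtMost-suc : ∀ k {d} → Below k d → AtMost (suc k) d
  Below⇒AtMost-suc k d<2^k = ℕP.≤-trans (ℕP.<⇒≤ d<2^k) (2^≤2^suc k)

  Below⇒Below-suc : ∀ k {d} → Below k d → Below (suc k) d
  Below⇒Below-suc k d<2^k = ℕP.<-≤-trans d<2^k (2^≤2^suc k)

  Below⇒<N : ∀ k {d} → 2 ^ k ℕ.≤ 2 ^ n → Below k d → d ℕ.< N
  Below⇒<N _ 2^k≤2^n d<2^k = ℕP.m≤n⇒m≤1+n (ℕP.≤-trans d<2^k 2^k≤2^n)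

  AtMost-combine : ∀ k {d₁ d₂ d} → d ℕ.≤ d₁ ℕ.+ d₂ → AtMost k d₁ → AtMost k d₂ → AtMost (suc k) d
  AtMost-combine k {d = d} d≤d₁+d₂ d₁≤2^k d₂≤2^k =
    subst (d ℕ.≤_) (sym (2^suc≡2^+2^ k)) (ℕP.≤-trans d≤d₁+d₂ (ℕP.+-mono-≤ d₁≤2^k d₂≤2^k))

  Below-combine : ∀ k {d₁ d₂ d} → d ℕ.≤ d₁ ℕ.+ d₂ → AtMost k d₁ → Below k d₂ → Below (suc k) d
  Below-combine k {d₁} {d₂} {d} d≤d₁+d₂ d₁≤2^k d₂<2^k = subst (suc d ℕ.≤_) (sym (2^suc≡2^+2^ k))
    (ℕP.≤-trans (s≤s d≤d₁+d₂) (subst (ℕ._≤ 2 ^ k ℕ.+ 2 ^ k) (ℕP.+-suc d₁ d₂) (ℕP.+-mono-≤ d₁≤2^k d₂<2^k)))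

  Slack-combine : ∀ k {d₁ d₂ d} → d ℕ.≤ d₁ ℕ.+ d₂ → AtMost k d₁ → Slack (suc k) d₂ → Slack k d
  Slack-combine k {d₁} {d₂} {d} d≤d₁+d₂ d₁≤2^k slack = begin
    d ℕ.+ 2 ^ k                   ≤⟨ ℕP.+-monoˡ-≤ (2 ^ k) (ℕP.≤-trans d≤d₁+d₂ (ℕP.+-monoˡ-≤ d₂ d₁≤2^k)) ⟩
    2 ^ k ℕ.+ d₂ ℕ.+ 2 ^ k        ≡⟨ rearrange (2 ^ k) d₂ ⟩
    d₂ ℕ.+ (2 ^ k ℕ.+ 2 ^ k)      ≡⟨ cong (d₂ ℕ.+_) (2^suc≡2^+2^ k) ⟨
    d₂ ℕ.+ 2 ^ suc k              ≤⟨ slack ⟩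
    2 ^ n                         ∎
    where
    open ℕP.≤-Reasoning
    rearrange : ∀ m d → m ℕ.+ d ℕ.+ m ≡ d ℕ.+ (m ℕ.+ m)
    rearrange m d = trans (cong (ℕ._+ m) (ℕP.+-comm m d)) (ℕP.+-assoc d m m)

  ≤⇒≤ᶻ : ∀ {x y x̃ ỹ} → x ≤S y → Over x̃ x → Over ỹ y → Near (Slack 0) ỹ x̃ → x̃ ≤ᶻ ỹ
  ≤⇒≤ᶻ (refl≤ _) x̃/x ỹ/x near =
    subst (_ ≤ᶻ_) (Over-unique x̃/x ỹ/x (Near-mono (Slack⇒<N 0) (Near-sym near))) (refl≤ᶻ _)
  ≤⇒≤ᶻ (to𝟘 _) _ o𝟘 _ = to𝟘ᶻ _
  ≤⇒≤ᶻ (gen₁ _) (oab {z′} z′/i+1) (oa {z} z/i) near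
    with over-unique (over-succ z/i) z′/i+1 (Slack⇒∣suc[i]-j∣<N 0 {z} {z′} (bound near refl refl))
  ... | refl = gen₁ᶻ z
  ≤⇒≤ᶻ (gen₂ _) (oa {z′} z′/i) (oac {z} z/i+1) near
    with over-unique (over-succ z′/i) z/i+1
           (Slack⇒∣suc[i]-j∣<N 0 {z′} {z} (subst (Slack 0) (ℤP.∣i-j∣≡∣j-i∣ z z′) (bound near refl refl)))
  ... | refl = gen₂ᶻ z′
  ≤⇒≤ᶻ (gen₃ _) (oab {z′} z′/i) (oac {z} z/i) near
    with over-unique z′/i z/i (subst (ℕ._< N) (ℤP.∣i-j∣≡∣j-i∣ z z′) (Slack⇒<N 0 (bound near refl refl)))
  ... | refl = gen₃ᶻ z

  ◀-Lift : ℕ → Cover → Elem → Set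
  ◀-Lift k x̃ y = Σ Cover λ ỹ → Over ỹ y × Dom⊆ x̃ ỹ × Near (AtMost k) x̃ ỹ

  ◁-Lift : ℕ → Cover → Cover → Elem → Set
  ◁-Lift k s̃ x̃ y = Σ Cover λ ỹ → Over ỹ y × Restr⊆ s̃ x̃ ỹ × (RestrEmpty s̃ x̃ ⊎ Near (Below k) s̃ ỹ)

  Lifts◀ : ℕ → Elem → Elem → Set
  Lifts◀ k x y = ∀ x̃ → Over x̃ x → ◀-Lift k x̃ y

  Lifts◁ : ℕ → Elem → Elem → Elem → Set
  Lifts◁ k s x y = ∀ s̃ x̃ → Over s̃ s → Over x̃ x → Near (Slack k) s̃ x̃ → ◁-Lift k s̃ x̃ y

  ◀-Lift-𝟘 : ∀ k y → ◀-Lift k 𝟘ᶻ y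
  ◀-Lift-𝟘 _ y = proj₁ (lift y) , proj₂ (lift y) , Dom⊆-𝟘 , Near-𝟘ˡ

  ◁-Lift-empty : ∀ k {s̃ x̃} y → RestrEmpty s̃ x̃ → ◁-Lift k s̃ x̃ y
  ◁-Lift-empty _ y empty = proj₁ (lift y) , proj₂ (lift y) , RestrEmpty⇒Restr⊆ empty , inj₁ empty

  lifts◀-zero : ∀ x y → ◀ zero x y → Lifts◀ zero x y
  lifts◀-zero x y (inj₁ y≤x) x̃ x̃/x =
    let (ỹ , ỹ/y , ỹ≤x̃ , near) = lift-below y≤x x̃/x in ỹ , ỹ/y , ≤ᶻ⇒Dom⊇ ỹ≤x̃ , near
  lifts◀-zero x y (inj₂ (e , ye≤x)) x̃ x̃/x with lift-below ye≤x x̃/x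
  ... | ẽ , ẽ/ye , ẽ≤x̃ , near with Over-∙ y e ẽ/ye
  ...   | inj₂ (ỹ , f̃ , ỹ/y , _ , refl , transfer) =
          ỹ , ỹ/y , Dom⊆-trans (≤ᶻ⇒Dom⊇ ẽ≤x̃) (Dom⊆-∘ ỹ f̃) , transfer near
  ...   | inj₁ refl with ≤ᶻ𝟘 ẽ≤x̃
  ...     | refl = ◀-Lift-𝟘 zero y

  lifts◁-zero : ∀ s x y → ◁ zero s x y → Lifts◁ zero s x y
  lifts◁-zero s x y (x≤s , refl) s̃ x̃ s̃/s x̃/x near =
    s̃ , s̃/s , ≤ᶻ⇒Restr⊆ (≤⇒≤ᶻ x≤s x̃/x s̃/s near) , inj₂ (Near-refl (s≤s z≤n))

  module Step (k : ℕ) (2^k+1≤2^n : 2 ^ suc k ℕ.≤ 2 ^ n)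
              (lifts◀ₖ : ∀ x y → ◀ k x y → Lifts◀ k x y)
              (lifts◁ₖ : ∀ s x y → ◁ k s x y → Lifts◁ k s x y) where

    2^k≤2^n : 2 ^ k ℕ.≤ 2 ^ n
    2^k≤2^n = ℕP.≤-trans (2^≤2^suc k) 2^k+1≤2^n

    lifts◀-suc : ∀ x y → ◀ (suc k) x y → Lifts◀ (suc k) x y
    lifts◀-suc x y (inj₁ x◁y) x̃ x̃/x with lifts◁ₖ x x y x◁y x̃ x̃ x̃/x x̃/x (Near-refl 2^k≤2^n)
    ... | ỹ , ỹ/y , x̃⊆ỹ , inj₂ near = ỹ , ỹ/y , Restr⊆-self⇒Dom⊆ x̃⊆ỹ , Near-mono (Below⇒AtMost-suc k) near
    ... | _ , _ , _ , inj₁ empty with Dom⊆-RestrEmpty⇒𝟘 (mkDom⊆ λ _ v∈x̃ → v∈x̃) empty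
    ...   | refl = ◀-Lift-𝟘 (suc k) y
    lifts◀-suc x y (inj₂ (inj₁ (e , x◀e , e◀y))) x̃ x̃/x =
      let (ẽ , ẽ/e , x̃⊆ẽ , near₁) = lifts◀ₖ x e x◀e x̃ x̃/x
          (ỹ , ỹ/y , ẽ⊆ỹ , near₂) = lifts◀ₖ e y e◀y ẽ ẽ/e
      in ỹ , ỹ/y , Dom⊆-trans x̃⊆ẽ ẽ⊆ỹ , Near-trans (AtMost-combine k) (Dom⊆-Indexed x̃⊆ẽ) near₁ near₂
    lifts◀-suc .(d ∙ f) .(d ∙ f′) (inj₂ (inj₂ (d , f , f′ , refl , f◀f′ , refl))) x̃ x̃/df
      with Over-∙ d f x̃/df
    ... | inj₁ refl = ◀-Lift-𝟘 (suc k) (d ∙ f′)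
    ... | inj₂ (d̃ , f̃ , d̃/d , f̃/f , refl , _) =
      let (f̃′ , f̃′/f′ , f̃⊆f̃′ , _) = lifts◀ₖ f f′ f◀f′ f̃ f̃/f
      in d̃ ∘ᶻ f̃′ , Over-∘ d̃/d f̃′/f′ , Dom⊆-∘ʳ d̃ f̃⊆f̃′ ,
         Near-∘ d̃ f̃′ (Near-sym (Near-∘ d̃ f̃ (Near-refl z≤n)))

    lifts◁-suc : ∀ s x y → ◁ (suc k) s x y → Lifts◁ (suc k) s x y
    lifts◁-suc s x y (inj₁ (e , x◁e , e◁y)) s̃ x̃ s̃/s x̃/x near
      with lifts◁ₖ s x e x◁e s̃ x̃ s̃/s x̃/x (Near-mono (Slack-suc⇒Slack k) near)
    ... | _ , _ , _ , inj₁ empty = ◁-Lift-empty (suc k) y empty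
    ... | ẽ , ẽ/e , x̃⊆ẽ , inj₂ near-ẽ
      with lifts◁ₖ s e y e◁y s̃ ẽ s̃/s ẽ/e (Near-mono (Below⇒Slack k 2^k+1≤2^n) near-ẽ)
    ...   | ỹ , ỹ/y , ẽ⊆ỹ , alt =
            ỹ , ỹ/y , Restr⊆-trans x̃⊆ẽ ẽ⊆ỹ ,
            ⊎-map (Restr⊆-RestrEmpty x̃⊆ẽ) (Near-mono (Below⇒Below-suc k)) alt
    lifts◁-suc s .(e₁ ∙ e₂) .(e₁′ ∙ e₂′) (inj₂ (inj₁ (e₁ , e₁′ , e₂ , e₂′ , refl , e₁◁e₁′ , e₂◁e₂′ , refl)))
               s̃ x̃ s̃/s x̃/e₁e₂ near
      with Over-∙ e₁ e₂ x̃/e₁e₂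
    ... | inj₁ refl = ◁-Lift-empty (suc k) (e₁′ ∙ e₂′) RestrEmpty-𝟘ʳ
    ... | inj₂ (ẽ₁ , ẽ₂ , ẽ₁/e₁ , ẽ₂/e₂ , refl , transfer) =
      let (ẽ₁′ , ẽ₁′/e₁′ , ẽ₁⊆ẽ₁′ , alt) =
            lifts◁ₖ s e₁ e₁′ e₁◁e₁′ s̃ ẽ₁ s̃/s ẽ₁/e₁ (transfer (Near-mono (Slack-suc⇒Slack k) near))
          (ẽ₂′ , ẽ₂′/e₂′ , ẽ₂⊆ẽ₂′ , _) =
            lifts◁ₖ e₂ e₂ e₂′ e₂◁e₂′ ẽ₂ ẽ₂ ẽ₂/e₂ ẽ₂/e₂ (Near-refl 2^k≤2^n)
      in ẽ₁′ ∘ᶻ ẽ₂′ , Over-∘ ẽ₁′/e₁′ ẽ₂′/e₂′ , Restr⊆-∘ ẽ₁⊆ẽ₁′ ẽ₂⊆ẽ₂′ ,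
         ⊎-map (RestrEmpty-∘ ẽ₂) (λ near′ → Near-∘ ẽ₁′ ẽ₂′ (Near-mono (Below⇒Below-suc k) near′)) alt
    lifts◁-suc s x y (inj₂ (inj₂ (s′ , x◁y , s◀s′))) s̃ x̃ s̃/s x̃/x near with is-𝟘ᶻ s̃
    ... | inj₁ refl = ◁-Lift-empty (suc k) y RestrEmpty-𝟘ˡ
    ... | inj₂ s̃≢𝟘 =
      let (s̃′ , s̃′/s′ , s̃⊆s̃′ , near-s̃′) = lifts◀ₖ s s′ s◀s′ s̃ s̃/s
          near′ = Near-trans (Slack-combine k) (Dom⊆-Indexed⁻ s̃≢𝟘 s̃⊆s̃′) (Near-sym near-s̃′) near
          (ỹ , ỹ/y , x̃⊆ỹ , alt) = lifts◁ₖ s′ x y x◁y s̃′ x̃ s̃′/s′ x̃/x near′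
      in ỹ , ỹ/y , Restr⊆-Dom⊆ s̃⊆s̃′ x̃⊆ỹ ,
         ⊎-map (RestrEmpty-Dom⊆ s̃⊆s̃′) (Near-trans (Below-combine k) (Dom⊆-Indexed s̃⊆s̃′) near-s̃′) alt

  lifts : ∀ k → 2 ^ k ℕ.≤ 2 ^ n →
          (∀ x y → ◀ k x y → Lifts◀ k x y) × (∀ s x y → ◁ k s x y → Lifts◁ k s x y)
  lifts zero _ = lifts◀-zero , lifts◁-zero
  lifts (suc k) 2^k+1≤2^n =
    let (lifts◀ₖ , lifts◁ₖ) = lifts k (ℕP.≤-trans (2^≤2^suc k) 2^k+1≤2^n)
    in Step.lifts◀-suc k 2^k+1≤2^n lifts◀ₖ lifts◁ₖ , Step.lifts◁-suc k 2^k+1≤2^n lifts◀ₖ lifts◁ₖ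

  2^suc≤2^n : ∀ {k} → k ℕ.< n → 2 ^ suc k ℕ.≤ 2 ^ n
  2^suc≤2^n = ℕP.^-monoʳ-≤ 2

  2^≤2^n : ∀ {k} → k ℕ.< n → 2 ^ k ℕ.≤ 2 ^ n
  2^≤2^n {k} k<n = ℕP.≤-trans (2^≤2^suc k) (2^suc≤2^n k<n)

  σ-holds : ∀ k → k ℕ.< n → σ k
  σ-holds k k<n x y (y◀x , x◁y)
    with lifts k (2^≤2^n k<n) | lift y
  ... | lifts◀ₖ , lifts◁ₖ | ỹ , ỹ/y
    with lifts◀ₖ y x y◀x ỹ ỹ/y
  ... | x̃ , x̃/x , ỹ⊆x̃ , near
    with lifts◁ₖ y x y x◁y ỹ x̃ ỹ/y x̃/x (Near-mono (AtMost⇒Slack k (2^suc≤2^n k<n)) near)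
  ... | ỹ′ , ỹ′/y , x̃⊆ỹ′ , inj₂ near′
    with Over-unique ỹ/y ỹ′/y (Near-mono (Below⇒<N k (2^≤2^n k<n)) near′)
  ...   | refl = ≤ᶻ⇒≤ (Dom⊇-Restr⊆⇒≤ᶻ ỹ⊆x̃ x̃⊆ỹ′) x̃/x ỹ/y
  σ-holds k k<n x y _ | _ | ỹ , ỹ/y | x̃ , x̃/x , ỹ⊆x̃ , near | _ , _ , _ , inj₁ empty
    with Dom⊆-RestrEmpty⇒𝟘 ỹ⊆x̃ empty
  ... | refl with Over-𝟘ᶻ ỹ/y
  ...   | refl = to𝟘 x

lemma9 : ∀ (ℓ : Level) (n : ℕ) → 2 ≤ n →
    ¬ Representable ℓ (Sn.𝒮 n)
    × (∀ (k : ℕ) → k < n → Formulas.σ (Sn.𝒮 n) k)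
lemma9 ℓ n _ = ¬representable ℓ n , Lifting.σ-holds n
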